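{- Let $T$ be a tree on $n\ge3$ vertices and let $\mathcal{P}$ be a separating path system of $T$. Then: (i) with the exception of at most one leaf, every leaf of $T$ is an endpoint of a path in $\mathcal{P}$; (ii) if a path in $\mathcal{P}$ has two leaves $u,v$ of $T$ as its endpoints, then some path in $\mathcal{P}$ has exactly one of $u,v$ as an endpoint; (iii) every vertex of degree two in $T$ is an endpoint of a path in $\mathcal{P}$.
   Context: For a graph $G$, a family $\mathcal{P}$ of subsets of $E(G)$ is a separating path system of $G$ if every member of $\mathcal{P}$ is (the edge set of) a path in $G$ and for every pair of distinct edges $e,e'\in E(G)$ there is a member of $\mathcal{P}$ containing exactly one of $e,e'$. -}

module Defs where

open import Data.Nat using (ℕ; _≤_)
open import Data.Fin using (Fin)
open import Data.List using (List; []; _∷_; head; last; length; filter)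
open import Data.List using (allFin) public
open import Data.List.Relation.Unary.Linked using (Linked)
open import Data.List.Relation.Unary.Unique.Propositional using (Unique)
open import Data.Maybe using (just)
open import Data.Product using (Σ; _×_; ∃)
open import Data.Sum using (_⊎_)
open import Data.Empty using (⊥)
open import Relation.Nullary using (¬_)
open import Relation.Binary using (Decidable; Symmetric)
open import Relation.Binary.PropositionalEquality using (_≡_)

record Graph (n : ℕ) : Set₁ where
  field
    Adj    : Fin n → Fin n → Set
    adj?   : Decidable Adj
    sym    : Symmetric Adj
    irrefl : ∀ v → ¬ Adj v v

module _ {n : ℕ} (G : Graph n) where
  open Graph G

  degree : Fin n → ℕ
  degree v = length (filter (adj? v) (allFin n))

  IsLeaf : Fin n → Set
  IsLeaf v = degree v ≡ 1

  Connected : Set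
  Connected = ∀ u v → Σ (List (Fin n)) λ xs →
    head xs ≡ just u × last xs ≡ just v × Linked Adj xs

  IsCycle : List (Fin n) → Set
  IsCycle xs = 3 ≤ length xs × Unique xs × Linked Adj xs ×
    Σ (Fin n) λ a → Σ (Fin n) λ b → head xs ≡ just a × last xs ≡ just b × Adj b a

  Acyclic : Set
  Acyclic = ∀ xs → ¬ IsCycle xs

  IsTree : Set
  IsTree = Connected × Acyclic

  record Path : Set where
    field
      verts      : List (Fin n)
      nontrivial : 2 ≤ length verts
      distinct   : Unique verts
      linked     : Linked Adj verts

  EdgeOn : List (Fin n) → Fin n → Fin n → Set
  EdgeOn []           a b = ⊥
  EdgeOn (x ∷ [])     a b = ⊥
  EdgeOn (x ∷ y ∷ xs) a b = ((x ≡ a × y ≡ b) ⊎ (x ≡ b × y ≡ a)) ⊎ EdgeOn (y ∷ xs) a b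

  _∈ₑ_ : (Fin n × Fin n) → Path → Set
  _∈ₑ_ (a Data.Product., b) p = EdgeOn (Path.verts p) a b

  IsEndpoint : Fin n → Path → Set
  IsEndpoint v p = head (Path.verts p) ≡ just v ⊎ last (Path.verts p) ≡ just v

  SameEdge : Fin n → Fin n → Fin n → Fin n → Set
  SameEdge a b c d = (a ≡ c × b ≡ d) ⊎ (a ≡ d × b ≡ c)

  IsSeparatingPathSystem : (m : ℕ) → (Fin m → Path) → Set
  IsSeparatingPathSystem m P =
    ∀ a b c d → Adj a b → Adj c d → ¬ SameEdge a b c d →
    ∃ λ i → ((a Data.Product., b) ∈ₑ P i × ¬ ((c Data.Product., d) ∈ₑ P i))
          ⊎ (¬ ((a Data.Product., b) ∈ₑ P i) × (c Data.Product., d) ∈ₑ P i)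

  EndpointOfSystem : (m : ℕ) → (Fin m → Path) → Fin n → Set
  EndpointOfSystem m P v = ∃ λ i → IsEndpoint v (P i)

-- A leaf u with neighbour w is an endpoint of a path exactly when the path uses the edge uw,
-- and a path through a vertex v without ending there uses two distinct edges at v. So a path
-- separating the leaf edges of two leaves u ≠ v (distinct edges: adjacent leaves would form a
-- whole component, impossible in a connected graph on ≥ 3 vertices) has exactly one of u, v as
-- an endpoint, which gives (i) and (ii); a path separating the two edges at a degree-two vertex
-- must end there, which gives (iii).
module Submission where

open import Defs
open import Data.Nat using (ℕ; _≤_; s≤s; z≤n)
open import Data.Fin using (Fin; zero; suc; _≟_)
open import Data.List using (List; []; _∷_; head; last; length; filter)
open import Data.List.Relation.Unary.Linked using (Linked; _∷_)
open import Data.List.Relation.Unary.Unique.Propositional using (Unique)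
open import Data.List.Relation.Unary.Unique.Propositional.Properties using (filter⁺; allFin⁺)
open import Data.List.Relation.Unary.AllPairs using (_∷_)
open import Data.List.Relation.Unary.All using ([]; _∷_)
import Data.List.Relation.Unary.All as All
open import Data.List.Relation.Unary.Any using (here; there)
open import Data.List.Membership.Propositional using (_∈_)
open import Data.List.Membership.Propositional.Properties using (∈-filter⁺; ∈-filter⁻; ∈-allFin)
open import Data.Maybe using (just)
open import Data.Product using (_×_; ∃; ∃₂; _,_; proj₂)
open import Data.Sum using (_⊎_; inj₁; inj₂; swap)
open import Function using (_∘_)
open import Data.Empty using (⊥-elim)
open import Relation.Nullary using (¬_; yes; no)
open import Relation.Binary.PropositionalEquality using (_≡_; _≢_; refl; sym; trans; subst)

length≡1⇒singleton : ∀ {A : Set} (xs : List A) → length xs ≡ 1 →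
  ∃ λ w → w ∈ xs × (∀ {c} → c ∈ xs → c ≡ w)
length≡1⇒singleton (w ∷ []) refl = w , here refl , λ { (here c≡w) → c≡w ; (there ()) }

length≡2⇒pair : ∀ {A : Set} (xs : List A) → length xs ≡ 2 → Unique xs →
  ∃₂ λ a b → a ≢ b × a ∈ xs × b ∈ xs × (∀ {c} → c ∈ xs → c ≡ a ⊎ c ≡ b)
length≡2⇒pair (a ∷ b ∷ []) refl ((a≢b ∷ []) ∷ _) =
  a , b , a≢b , here refl , there (here refl) ,
  λ { (here c≡a) → inj₁ c≡a ; (there (here c≡b)) → inj₂ c≡b ; (there (there ())) }

∃-avoiding-two : ∀ {n} → 3 ≤ n → (u v : Fin n) → ∃ λ x → x ≢ u × x ≢ v
∃-avoiding-two (s≤s (s≤s (s≤s _))) u v with zero ≟ u | zero ≟ v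
... | no 0≢u   | no 0≢v = zero , 0≢u , 0≢v
... | yes refl | _ with suc zero ≟ v
...   | no 1≢v   = suc zero , (λ ()) , 1≢v
...   | yes refl = suc (suc zero) , (λ ()) , (λ ())
∃-avoiding-two (s≤s (s≤s (s≤s _))) u v | no _ | yes refl with suc zero ≟ u
...   | no 1≢u   = suc zero , 1≢u , (λ ())
...   | yes refl = suc (suc zero) , (λ ()) , (λ ())

module _ {n : ℕ} (G : Graph n) where
  open Graph G renaming (sym to Adj-sym)

  neighbours : Fin n → List (Fin n)
  neighbours v = filter (adj? v) (allFin n)

  ∈-neighbours⁺ : ∀ {v w} → Adj v w → w ∈ neighbours v
  ∈-neighbours⁺ {v} {w} v~w = ∈-filter⁺ (adj? v) (∈-allFin w) v~w

  ∈-neighbours⁻ : ∀ {v w} → w ∈ neighbours v → Adj v w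
  ∈-neighbours⁻ {v} w∈ = proj₂ (∈-filter⁻ (adj? v) {xs = allFin n} w∈)

  leaf⇒uniqueNeighbour : ∀ {v} → IsLeaf G v →
    ∃ λ w → Adj v w × (∀ {c} → Adj v c → c ≡ w)
  leaf⇒uniqueNeighbour {v} deg≡1 with length≡1⇒singleton (neighbours v) deg≡1
  ... | w , w∈ , only-w = w , ∈-neighbours⁻ w∈ , λ v~c → only-w (∈-neighbours⁺ v~c)

  degree≡2⇒twoNeighbours : ∀ {v} → degree G v ≡ 2 →
    ∃₂ λ a b → a ≢ b × Adj v a × Adj v b × (∀ {c} → Adj v c → c ≡ a ⊎ c ≡ b)
  degree≡2⇒twoNeighbours {v} deg≡2
    with length≡2⇒pair (neighbours v) deg≡2 (filter⁺ (adj? v) (allFin⁺ n))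
  ... | a , b , a≢b , a∈ , b∈ , a-or-b =
    a , b , a≢b , ∈-neighbours⁻ a∈ , ∈-neighbours⁻ b∈ , λ v~c → a-or-b (∈-neighbours⁺ v~c)

  walk-preserves : {S : Fin n → Set} → (∀ {y z} → S y → Adj y z → S z) →
    ∀ y ys {x} → Linked Adj (y ∷ ys) → S y → last (y ∷ ys) ≡ just x → S x
  walk-preserves closed y []       _           Sy refl = Sy
  walk-preserves closed y (z ∷ zs) (y~z ∷ lk) Sy eq   = walk-preserves closed z zs lk (closed Sy y~z) eq

  -- Adjacent leaves u, v would make {u, v} closed under adjacency, so no walk leaves it.
  leaves-nonadjacent : 3 ≤ n → Connected G → ∀ {u v} → IsLeaf G u → IsLeaf G v → ¬ Adj u v
  leaves-nonadjacent 3≤n connected {u} {v} leaf-u leaf-v u~v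
    with leaf⇒uniqueNeighbour leaf-u | leaf⇒uniqueNeighbour leaf-v | ∃-avoiding-two 3≤n u v
  ... | wu , _ , only-wu | wv , _ , only-wv | x , x≢u , x≢v with connected u x
  ...   | y ∷ ys , refl , last≡x , walk with walk-preserves closed y ys walk (inj₁ refl) last≡x
    where
    closed : ∀ {y z} → y ≡ u ⊎ y ≡ v → Adj y z → z ≡ u ⊎ z ≡ v
    closed (inj₁ refl) u~z = inj₂ (trans (only-wu u~z) (sym (only-wu u~v)))
    closed (inj₂ refl) v~z = inj₁ (trans (only-wv v~z) (sym (only-wv (Adj-sym u~v))))
  ...     | inj₁ x≡u = x≢u x≡u
  ...     | inj₂ x≡v = x≢v x≡v

  EdgeOn⇒Adj : ∀ xs {a b} → Linked Adj xs → EdgeOn G xs a b → Adj a b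
  EdgeOn⇒Adj (x ∷ y ∷ xs) (x~y ∷ _)  (inj₁ (inj₁ (refl , refl))) = x~y
  EdgeOn⇒Adj (x ∷ y ∷ xs) (x~y ∷ _)  (inj₁ (inj₂ (refl , refl))) = Adj-sym x~y
  EdgeOn⇒Adj (x ∷ y ∷ xs) (_   ∷ lk) (inj₂ e)                    = EdgeOn⇒Adj (y ∷ xs) lk e

  EdgeOn⇒∈ : ∀ xs {a b} → EdgeOn G xs a b → a ∈ xs
  EdgeOn⇒∈ (x ∷ y ∷ xs) (inj₁ (inj₁ (refl , refl))) = here refl
  EdgeOn⇒∈ (x ∷ y ∷ xs) (inj₁ (inj₂ (refl , refl))) = there (here refl)
  EdgeOn⇒∈ (x ∷ y ∷ xs) (inj₂ e)                    = there (EdgeOn⇒∈ (y ∷ xs) e)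

  last⇒∈ : ∀ (xs : List (Fin n)) {v} → last xs ≡ just v → v ∈ xs
  last⇒∈ (x ∷ [])     refl = here refl
  last⇒∈ (x ∷ y ∷ xs) eq   = there (last⇒∈ (y ∷ xs) eq)

  head≢last : ∀ (xs : List (Fin n)) {u v} → Unique xs → 2 ≤ length xs →
    head xs ≡ just u → last xs ≡ just v → u ≢ v
  head≢last (x ∷ [])     _        (s≤s ()) _ _
  head≢last (x ∷ y ∷ xs) (x∉ ∷ _) _ refl last≡v refl = All.lookup x∉ (last⇒∈ (y ∷ xs) last≡v) refl

  head⇒EdgeOn : ∀ (xs : List (Fin n)) {v} → 2 ≤ length xs → head xs ≡ just v → ∃ (EdgeOn G xs v)
  head⇒EdgeOn (x ∷ [])     (s≤s ()) _
  head⇒EdgeOn (x ∷ y ∷ xs) _        refl = y , inj₁ (inj₁ (refl , refl))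

  last⇒EdgeOn : ∀ (xs : List (Fin n)) {v} → 2 ≤ length xs → last xs ≡ just v → ∃ (EdgeOn G xs v)
  last⇒EdgeOn (x ∷ [])         (s≤s ()) _
  last⇒EdgeOn (x ∷ y ∷ [])     _ refl = x , inj₁ (inj₂ (refl , refl))
  last⇒EdgeOn (x ∷ y ∷ z ∷ xs) _ eq with last⇒EdgeOn (y ∷ z ∷ xs) (s≤s (s≤s z≤n)) eq
  ... | w , e = w , inj₂ e

  Interior : List (Fin n) → Fin n → Set
  Interior xs v = ∃₂ λ s t → s ≢ t × EdgeOn G xs v s × EdgeOn G xs v t

  ∈⇒end⊎interior : ∀ xs {v} → Unique xs → v ∈ xs →
    (head xs ≡ just v ⊎ last xs ≡ just v) ⊎ Interior xs v
  ∈⇒end⊎interior (x ∷ [])         _          (here refl)          = inj₁ (inj₁ refl)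
  ∈⇒end⊎interior (x ∷ y ∷ xs)     _          (here refl)          = inj₁ (inj₁ refl)
  ∈⇒end⊎interior (x ∷ y ∷ [])     _          (there (here refl))  = inj₁ (inj₂ refl)
  ∈⇒end⊎interior (x ∷ y ∷ z ∷ xs) (x∉ ∷ uniq) (there v∈)
    with ∈⇒end⊎interior (y ∷ z ∷ xs) uniq v∈
  ... | inj₁ (inj₁ refl) = inj₂ (x , z , All.lookup x∉ (there (here refl)) ,
                                 inj₁ (inj₂ (refl , refl)) , inj₂ (inj₁ (inj₁ (refl , refl))))
  ... | inj₁ (inj₂ last≡v) = inj₁ (inj₂ last≡v)
  ... | inj₂ (s , t , s≢t , es , et) = inj₂ (s , t , s≢t , inj₂ es , inj₂ et)

  pendant⇒endpoint : ∀ (p : Path G) {v s} → EdgeOn G (Path.verts p) v s →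
    (∀ {t} → EdgeOn G (Path.verts p) v t → t ≡ s) → IsEndpoint G v p
  pendant⇒endpoint p e only-s
    with ∈⇒end⊎interior (Path.verts p) (Path.distinct p) (EdgeOn⇒∈ (Path.verts p) e)
  ... | inj₁ end = end
  ... | inj₂ (s , t , s≢t , es , et) = ⊥-elim (s≢t (trans (only-s es) (sym (only-s et))))

  oneOfTwoEdges⇒endpoint : ∀ (p : Path G) {v s t} → (∀ {c} → Adj v c → c ≡ s ⊎ c ≡ t) →
    EdgeOn G (Path.verts p) v s → ¬ EdgeOn G (Path.verts p) v t → IsEndpoint G v p
  oneOfTwoEdges⇒endpoint p {v} {s} s-or-t es ¬et = pendant⇒endpoint p es only-s
    where
    only-s : ∀ {c} → EdgeOn G (Path.verts p) v c → c ≡ s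
    only-s e with s-or-t (EdgeOn⇒Adj (Path.verts p) (Path.linked p) e)
    ... | inj₁ c≡s  = c≡s
    ... | inj₂ refl = ⊥-elim (¬et e)

  endpoint⇒EdgeOn : ∀ (p : Path G) {v} → IsEndpoint G v p → ∃ (EdgeOn G (Path.verts p) v)
  endpoint⇒EdgeOn p (inj₁ head≡v) = head⇒EdgeOn (Path.verts p) (Path.nontrivial p) head≡v
  endpoint⇒EdgeOn p (inj₂ last≡v) = last⇒EdgeOn (Path.verts p) (Path.nontrivial p) last≡v

  module _ (p : Path G) {u w} (only-w : ∀ {c} → Adj u c → c ≡ w) where

    pathNeighbour≡ : ∀ {t} → EdgeOn G (Path.verts p) u t → t ≡ w
    pathNeighbour≡ e = only-w (EdgeOn⇒Adj (Path.verts p) (Path.linked p) e)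

    leafEdge⇒endpoint : EdgeOn G (Path.verts p) u w → IsEndpoint G u p
    leafEdge⇒endpoint e = pendant⇒endpoint p e pathNeighbour≡

    endpoint⇒leafEdge : IsEndpoint G u p → EdgeOn G (Path.verts p) u w
    endpoint⇒leafEdge end with endpoint⇒EdgeOn p end
    ... | t , e = subst (EdgeOn G (Path.verts p) u) (pathNeighbour≡ e) e

  SeparatesEndpoints : ∀ {m} → (Fin m → Path G) → Fin n → Fin n → Set
  SeparatesEndpoints P u v = ∃ λ j → (IsEndpoint G u (P j) × ¬ IsEndpoint G v (P j))
                                   ⊎ (¬ IsEndpoint G u (P j) × IsEndpoint G v (P j))

  module _ {m} (P : Fin m → Path G) (sep : IsSeparatingPathSystem G m P) where

    leaves-separated : 3 ≤ n → Connected G → ∀ {u v} → IsLeaf G u → IsLeaf G v → u ≢ v →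
      SeparatesEndpoints P u v
    leaves-separated 3≤n connected {u} {v} leaf-u leaf-v u≢v
      with leaf⇒uniqueNeighbour leaf-u | leaf⇒uniqueNeighbour leaf-v
    ... | wu , u~wu , only-wu | wv , v~wv , only-wv with sep u wu v wv u~wu v~wv distinct-edges
      where
      distinct-edges : ¬ SameEdge G u wu v wv
      distinct-edges (inj₁ (u≡v , _))     = u≢v u≡v
      distinct-edges (inj₂ (refl , wu≡v)) = leaves-nonadjacent 3≤n connected leaf-u leaf-v
                                              (subst (Adj u) wu≡v u~wu)
    ...   | j , inj₁ (eu , ¬ev) = j , inj₁ (leafEdge⇒endpoint (P j) only-wu eu ,
                                            λ end → ¬ev (endpoint⇒leafEdge (P j) only-wv end))
    ...   | j , inj₂ (¬eu , ev) = j , inj₂ ((λ end → ¬eu (endpoint⇒leafEdge (P j) only-wu end)) ,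
                                            leafEdge⇒endpoint (P j) only-wv ev)

    degree≡2⇒endpoint : ∀ {v} → degree G v ≡ 2 → EndpointOfSystem G m P v
    degree≡2⇒endpoint {v} deg≡2 with degree≡2⇒twoNeighbours deg≡2
    ... | a , b , a≢b , v~a , v~b , a-or-b with sep v a v b v~a v~b distinct-edges
      where
      distinct-edges : ¬ SameEdge G v a v b
      distinct-edges (inj₁ (_ , a≡b))    = a≢b a≡b
      distinct-edges (inj₂ (refl , a≡v)) = irrefl v (subst (Adj v) a≡v v~a)
    ...   | i , inj₁ (ea , ¬eb) = i , oneOfTwoEdges⇒endpoint (P i) a-or-b ea ¬eb
    ...   | i , inj₂ (¬ea , eb) = i , oneOfTwoEdges⇒endpoint (P i) (swap ∘ a-or-b) eb ¬ea

lemma4 : (n : ℕ) → 3 ≤ n → (T : Graph n) → IsTree T →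
    (m : ℕ) → (P : Fin m → Path T) → IsSeparatingPathSystem T m P →
    (∀ u v → IsLeaf T u → IsLeaf T v → ¬ u ≡ v →
      EndpointOfSystem T m P u ⊎ EndpointOfSystem T m P v)
    ×
    (∀ i u v → IsLeaf T u → IsLeaf T v →
      head (Path.verts (P i)) ≡ just u → last (Path.verts (P i)) ≡ just v →
      ∃ λ j → (IsEndpoint T u (P j) × ¬ IsEndpoint T v (P j))
            ⊎ (¬ IsEndpoint T u (P j) × IsEndpoint T v (P j)))
    ×
    (∀ v → degree T v ≡ 2 → EndpointOfSystem T m P v)
lemma4 n 3≤n T (connected , _) m P sep = some-endpoint , separated , λ v → degree≡2⇒endpoint T P sep
  where
  separated : ∀ i u v → IsLeaf T u → IsLeaf T v →
    head (Path.verts (P i)) ≡ just u → last (Path.verts (P i)) ≡ just v → SeparatesEndpoints T P u v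
  separated i u v leaf-u leaf-v head≡u last≡v = leaves-separated T P sep 3≤n connected leaf-u leaf-v
    (head≢last T (Path.verts (P i)) (Path.distinct (P i)) (Path.nontrivial (P i)) head≡u last≡v)

  some-endpoint : ∀ u v → IsLeaf T u → IsLeaf T v → u ≢ v →
    EndpointOfSystem T m P u ⊎ EndpointOfSystem T m P v
  some-endpoint u v leaf-u leaf-v u≢v with leaves-separated T P sep 3≤n connected leaf-u leaf-v u≢v
  ... | j , inj₁ (end-u , _) = inj₁ (j , end-u)
  ... | j , inj₂ (_ , end-v) = inj₂ (j , end-v)
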